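{- Let $\mathbf{p}\in\mathbf{P}$ be a profile whose size $|\mathbf{p}|$ is a prime number. Then $\mathbf{p}$ is irreducible.
   Context: A profile is a sequence $\mathbf{p}=(p_i)_{i\in\mathbb{N}}$ of natural numbers for which there exists $h\ge -1$ with $p_i\ge 1$ for $0\le i\le h$ and $p_i=0$ for $i>h$. $\mathbf{P}$ is the set of profiles with elementwise sum and product $(\mathbf{p}\times\mathbf{q})_i = p_i\sum_{j=0}^i q_j + q_i\sum_{j=0}^i p_j - p_i q_i$; $(1)=(1,0,0,\ldots)$ is the multiplicative identity. The size is $|\mathbf{p}|=\sum_i p_i$. A profile $\mathbf{p}$ is irreducible if whenever $\mathbf{p}=\mathbf{q}\times\mathbf{r}$ with $\mathbf{q},\mathbf{r}\in\mathbf{P}$, one of $\mathbf{q},\mathbf{r}$ equals $(1)$. -}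

module Defs where

open import Data.Nat using (ℕ; zero; suc; _+_; _*_; _∸_; _≤_; _<_)
open import Data.Product using (Σ; _×_; _,_)
open import Relation.Binary.PropositionalEquality using (_≡_)

Seq : Set
Seq = ℕ → ℕ

sumTo : Seq → ℕ → ℕ
sumTo p zero    = p zero
sumTo p (suc i) = sumTo p i + p (suc i)

sumBelow : Seq → ℕ → ℕ
sumBelow p zero    = zero
sumBelow p (suc n) = sumBelow p n + p n

-- A profile: there is n (= h + 1, with h ≥ -1) such that p i ≥ 1 for i < n
-- and p i = 0 for i ≥ n.
record Profile : Set where
  constructor profile
  field
    seq      : Seq
    len      : ℕ
    pos      : ∀ i → i < len → 1 ≤ seq i
    vanishes : ∀ i → len ≤ i → seq i ≡ 0
open Profile public

_≈P_ : Profile → Profile → Set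
p ≈P q = ∀ i → seq p i ≡ seq q i

-- Size |p| = Σ_i p_i (finite, as p vanishes from index len on).
size : Profile → ℕ
size p = sumBelow (seq p) (len p)

mulSeq : Seq → Seq → Seq
mulSeq p q i = (p i * sumTo q i + q i * sumTo p i) ∸ p i * q i

oneSeq : Seq
oneSeq zero    = 1
oneSeq (suc _) = 0

one : Profile
one = profile oneSeq 1 pos1 van1
  where
  open import Data.Nat using (s≤s; z≤n)
  pos1 : ∀ i → i < 1 → 1 ≤ oneSeq i
  pos1 zero _ = s≤s z≤n
  pos1 (suc i) (s≤s ())
  van1 : ∀ i → 1 ≤ i → oneSeq i ≡ 0
  van1 (suc i) _ = Relation.Binary.PropositionalEquality.refl
    where import Relation.Binary.PropositionalEquality

open import Data.Sum using (_⊎_)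
Irreducible : Profile → Set
Irreducible p = ∀ (q r : Profile) → p ≈P' mulSeq (seq q) (seq r) → (q ≈P one) ⊎ (r ≈P one)
  where
  _≈P'_ : Profile → Seq → Set
  p ≈P' s = ∀ i → seq p i ≡ s i

-- The partial sums of q × r are the products of the partial sums of q and r,
-- because (q × r)_i is exactly (Q + q_i)(R + r_i) − QR for the preceding partial
-- sums Q, R.  Hence |q × r| = |q| |r|, a prime size forces one factor to have
-- size 1, and the only profile of size 1 is (1), since a profile with n nonzero
-- entries has size at least n.
module Submission where

open import Defs
open import Data.Nat.Primality using (Prime; prime⇒irreducible; prime⇒nonZero)
open import Data.Nat
open import Data.Nat.Properties
open import Data.Nat.Divisibility using (m∣m*n)
open import Data.Nat.Tactic.RingSolver using (solve-∀)
open import Data.Sum using (_⊎_; inj₁; inj₂; map)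
open import Data.Empty using (⊥-elim)
open import Relation.Binary.PropositionalEquality

prime[m*n]⇒m≡1⊎n≡1 : ∀ m n → Prime (m * n) → m ≡ 1 ⊎ n ≡ 1
prime[m*n]⇒m≡1⊎n≡1 m n pr with prime⇒irreducible pr (m∣m*n n)
... | inj₁ m≡1   = inj₁ m≡1
... | inj₂ m≡m*n = inj₂ (sym (*-cancelˡ-≡ 1 n m {{m≢0}} (trans (*-identityʳ m) m≡m*n)))
  where
  m≢0 : NonZero m
  m≢0 = m*n≢0⇒m≢0 m {{prime⇒nonZero pr}}

sumTo≡sumBelow : ∀ s i → sumTo s i ≡ sumBelow s (suc i)
sumTo≡sumBelow s zero    = refl
sumTo≡sumBelow s (suc i) = cong (_+ s (suc i)) (sumTo≡sumBelow s i)

sumBelow-cong : ∀ {s t} → (∀ i → s i ≡ t i) → ∀ n → sumBelow s n ≡ sumBelow t n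
sumBelow-cong s≗t zero    = refl
sumBelow-cong s≗t (suc n) = cong₂ _+_ (sumBelow-cong s≗t n) (s≗t n)

sumBelow-stable : ∀ {s m n} → (∀ i → m ≤ i → s i ≡ 0) → m ≤′ n →
                  sumBelow s n ≡ sumBelow s m
sumBelow-stable         vanish ≤′-refl             = refl
sumBelow-stable {s} {m} vanish (≤′-step {n} m≤′n) = begin
  sumBelow s n + s n  ≡⟨ cong₂ _+_ (sumBelow-stable vanish m≤′n) (vanish n (≤′⇒≤ m≤′n)) ⟩
  sumBelow s m + 0    ≡⟨ +-identityʳ _ ⟩
  sumBelow s m        ∎
  where open ≡-Reasoning

mulSeq≡ : ∀ q r n → mulSeq q r n ≡
          q n * sumBelow r n + r n * sumBelow q n + q n * r n
mulSeq≡ q r n = begin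
  (a * sumTo r n + b * sumTo q n) ∸ a * b
    ≡⟨ cong₂ (λ x y → (a * x + b * y) ∸ a * b) (sumTo≡sumBelow r n) (sumTo≡sumBelow q n) ⟩
  (a * (R + b) + b * (Q + a)) ∸ a * b
    ≡⟨ cong (_∸ a * b) (expand a b Q R) ⟩
  (a * R + b * Q + a * b) + a * b ∸ a * b
    ≡⟨ m+n∸n≡m _ (a * b) ⟩
  a * R + b * Q + a * b ∎
  where
  open ≡-Reasoning
  a = q n
  b = r n
  Q = sumBelow q n
  R = sumBelow r n
  expand : ∀ a b Q R → a * (R + b) + b * (Q + a) ≡ (a * R + b * Q + a * b) + a * b
  expand = solve-∀

sumBelow-mulSeq : ∀ q r n → sumBelow (mulSeq q r) n ≡ sumBelow q n * sumBelow r n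
sumBelow-mulSeq q r zero    = refl
sumBelow-mulSeq q r (suc n) = begin
  sumBelow (mulSeq q r) n + mulSeq q r n
    ≡⟨ cong₂ _+_ (sumBelow-mulSeq q r n) (mulSeq≡ q r n) ⟩
  Q * R + (q n * R + r n * Q + q n * r n)
    ≡⟨ factor Q R (q n) (r n) ⟩
  (Q + q n) * (R + r n) ∎
  where
  open ≡-Reasoning
  Q = sumBelow q n
  R = sumBelow r n
  factor : ∀ Q R a b → Q * R + (a * R + b * Q + a * b) ≡ (Q + a) * (R + b)
  factor = solve-∀

sumBelow≡size : ∀ p {n} → len p ≤ n → sumBelow (seq p) n ≡ size p
sumBelow≡size p len≤n = sumBelow-stable (vanishes p) (≤⇒≤′ len≤n)

size-mulSeq : ∀ p q r → (∀ i → seq p i ≡ mulSeq (seq q) (seq r) i) →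
              size p ≡ size q * size r
size-mulSeq p q r p≗q×r = begin
  size p                                ≡⟨ sym (sumBelow≡size p (m≤n⇒m≤n+o (len r) (m≤m+n (len p) (len q)))) ⟩
  sumBelow (seq p) N                    ≡⟨ sumBelow-cong p≗q×r N ⟩
  sumBelow (mulSeq (seq q) (seq r)) N   ≡⟨ sumBelow-mulSeq (seq q) (seq r) N ⟩
  sumBelow (seq q) N * sumBelow (seq r) N
    ≡⟨ cong₂ _*_ (sumBelow≡size q (m≤n⇒m≤n+o (len r) (m≤n+m (len q) (len p))))
                 (sumBelow≡size r (m≤n+m (len r) (len p + len q))) ⟩
  size q * size r                       ∎
  where
  open ≡-Reasoning
  N = len p + len q + len r

n≤sumBelow : ∀ p n → n ≤ len p → n ≤ sumBelow (seq p) n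
n≤sumBelow p zero    _     = z≤n
n≤sumBelow p (suc n) n<len = begin
  suc n                      ≡⟨ +-comm 1 n ⟩
  n + 1                      ≤⟨ +-mono-≤ (n≤sumBelow p n (<⇒≤ n<len)) (pos p n n<len) ⟩
  sumBelow (seq p) n + seq p n ∎
  where open ≤-Reasoning

len≤size : ∀ p → len p ≤ size p
len≤size p = n≤sumBelow p (len p) ≤-refl

size≡1⇒≈one : ∀ p → size p ≡ 1 → p ≈P one
size≡1⇒≈one p size≡1 with len p | len≤size p | vanishes p
... | zero        | _        | _      = ⊥-elim (0≢1+n size≡1)
... | suc zero    | _        | vanish = λ where
  zero    → size≡1
  (suc i) → vanish (suc i) (s≤s z≤n)
... | suc (suc _) | len≤size | _      =
  ⊥-elim (n≮0 (≤-pred (≤-trans len≤size (≤-reflexive size≡1))))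

lemma7 : (p : Profile) → Prime (size p) → Irreducible p
lemma7 p pr q r p≗q×r =
  map (size≡1⇒≈one q) (size≡1⇒≈one r)
      (prime[m*n]⇒m≡1⊎n≡1 (size q) (size r)
        (subst Prime (size-mulSeq p q r p≗q×r) pr))
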